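{- If $G$ is a weak IASI graph, then the maximum number of vertices of $G$ that are not mono-indexed (in a weak IASI of $G$) is equal to the independence number $\alpha(G)$.
   Context: All graphs are simple, finite and have no isolated vertices. For $A,B\subseteq\mathbb{N}_0$, $A+B=\{a+b: a\in A, b\in B\}$. An integer additive set-indexer (IASI) of $G$ is an injective $f:V(G)\to 2^{\mathbb{N}_0}$ such that $g_f(uv)=f(u)+f(v)$ is injective on $E(G)$. It is a weak IASI if $|g_f(uv)|=\max(|f(u)|,|f(v)|)$ for every edge $uv$; a graph admitting one is a weak IASI graph. A vertex is mono-indexed if its set-label has cardinality $1$. The independence number $\alpha(G)$ is the maximum size of a set of pairwise non-adjacent vertices. -}

module Defs where

open import Data.Nat using (ℕ; _≤_; _≡ᵇ_)
open import Data.Nat.Properties using (_≟_)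
open import Data.Bool using (not)
open import Data.Fin using (Fin)
open import Data.Fin.Subset using (Subset; _∈_; ∣_∣)
open import Data.Vec using (tabulate)
open import Data.List using (List; length; deduplicate; cartesianProductWith)
import Data.List.Membership.Propositional as LM
open import Data.Product using (Σ; _×_; ∃)
open import Data.Sum using (_⊎_)
open import Data.Empty using (⊥)
open import Relation.Binary.PropositionalEquality using (_≡_)
open import Relation.Nullary using (¬_)
open import Function.Bundles using (_⇔_)

record Graph (n : ℕ) : Set₁ where
  field
    E       : Fin n → Fin n → Set
    sym     : ∀ {u v} → E u v → E v u
    irrefl  : ∀ {u} → ¬ E u u
    noIsol  : ∀ u → ∃ λ v → E u v
open Graph public

-- Finite subsets of ℕ₀, represented by lists (read as the set of their elements).
FinSet : Set
FinSet = List ℕ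

_≃ₛ_ : FinSet → FinSet → Set
A ≃ₛ B = ∀ x → (x LM.∈ A) ⇔ (x LM.∈ B)

card : FinSet → ℕ
card A = length (deduplicate _≟_ A)

_⊕_ : FinSet → FinSet → FinSet
A ⊕ B = cartesianProductWith Data.Nat._+_ A B

max : ℕ → ℕ → ℕ
max = Data.Nat._⊔_

module _ {n : ℕ} (G : Graph n) where

  record IsIASI (f : Fin n → FinSet) : Set where
    field
      vinj : ∀ u v → f u ≃ₛ f v → u ≡ v
      einj : ∀ u v u' v' → E G u v → E G u' v' →
             (f u ⊕ f v) ≃ₛ (f u' ⊕ f v') →
             (u ≡ u' × v ≡ v') ⊎ (u ≡ v' × v ≡ u')

  record IsWeakIASI (f : Fin n → FinSet) : Set where
    field
      iasi : IsIASI f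
      weak : ∀ u v → E G u v → card (f u ⊕ f v) ≡ max (card (f u)) (card (f v))

  IsWeakIASIGraph : Set
  IsWeakIASIGraph = Σ (Fin n → FinSet) IsWeakIASI

  nonMono : (Fin n → FinSet) → Subset n
  nonMono f = tabulate (λ v → not (card (f v) ≡ᵇ 1))

  Independent : Subset n → Set
  Independent S = ∀ u v → u ∈ S → v ∈ S → ¬ E G u v

  IsIndependenceNumber : ℕ → Set
  IsIndependenceNumber k =
    (Σ (Subset n) λ S → Independent S × ∣ S ∣ ≡ k) ×
    (∀ S → Independent S → ∣ S ∣ ≤ k)

module Submission where

-- Vertices that are not mono-indexed form an independent set: if A and B both have at
-- least two elements then |A + B| > max(|A|, |B|), which weakness forbids along an edge
-- (labels are nonempty, since an empty label would empty its neighbour's label as well and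
-- break injectivity). Conversely, an independent set S is the non-mono-indexed set of the
-- labelling i ↦ {2ⁱ, 2ⁱ + 1} for i ∈ S and i ↦ {2ⁱ} otherwise: every edge has at most one
-- doubled endpoint, so weakness holds, and the least element 2ᵘ + 2ᵛ of the edge label
-- determines the edge by uniqueness of binary expansions.

open import Defs hiding (sym)
open import Data.Nat using (ℕ; zero; suc; _+_; _*_; _^_; _≤_; _<_; _⊔_; _≡ᵇ_; z≤n; s≤s)
open import Data.Nat.Properties
open import Data.Bool using (Bool; true; false; not; T)
open import Data.Fin using (Fin; toℕ)
open import Data.Fin.Properties using (toℕ-injective; injective⇒≤)
open import Data.Fin.Subset using (Subset; ∣_∣)
import Data.Fin.Subset as Subset
open import Data.Vec using (lookup; tabulate)
open import Data.Vec.Properties using ([]=⇒lookup; lookup⇒[]=; lookup∘tabulate; tabulate∘lookup; tabulate-cong)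
open import Data.List using (List; []; _∷_; length; map; deduplicate)
import Data.List as List
open import Data.List.Properties using (length-map)
open import Data.List.Extrema.Nat using (argmax-all; xs≤max) renaming (max to maximum; ⊥≤max to x≤maximum)
open import Data.List.Membership.Propositional using (_∈_)
open import Data.List.Membership.Propositional.Properties
  using (∈-lookup; ∈-cartesianProductWith⁺; ∈-cartesianProductWith⁻; ∈-deduplicate⁺; ∈-deduplicate⁻; ∈-map⁻)
open import Data.List.Membership.Setoid.Properties using (index-injective)
open import Data.List.Relation.Binary.Subset.Propositional using (_⊆_)
open import Data.List.Relation.Unary.Any using (here; there; index)
import Data.List.Relation.Unary.All as All
open import Data.List.Relation.Unary.AllPairs using (_∷_)
open import Data.List.Relation.Unary.Unique.Propositional using (Unique)
import Data.List.Relation.Unary.Unique.Propositional.Properties as Unique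
open import Data.List.Relation.Unary.Unique.DecPropositional.Properties using (deduplicate-!)
open import Data.Product using (Σ; _×_; _,_; ∃₂)
open import Data.Sum using (_⊎_; inj₁; inj₂)
open import Relation.Nullary using (contradiction)
open import Relation.Binary using (tri<; tri≈; tri>)
open import Relation.Binary.PropositionalEquality
open import Function.Bundles using (Equivalence)
open import Function.Construct.Identity using (⇔-id)

Unique⇒lookup-injective : ∀ {xs : List ℕ} → Unique xs → ∀ {i j} → List.lookup xs i ≡ List.lookup xs j → i ≡ j
Unique⇒lookup-injective {_ ∷ _} _ {Fin.zero} {Fin.zero} _ = refl
Unique⇒lookup-injective {_ ∷ _} (x∉ ∷ _) {Fin.zero} {Fin.suc j} eq = contradiction eq (All.lookup x∉ (∈-lookup j))
Unique⇒lookup-injective {_ ∷ _} (x∉ ∷ _) {Fin.suc i} {Fin.zero} eq = contradiction (sym eq) (All.lookup x∉ (∈-lookup i))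
Unique⇒lookup-injective {_ ∷ _} (_ ∷ u) {Fin.suc i} {Fin.suc j} eq = cong Fin.suc (Unique⇒lookup-injective u eq)

Unique∧⊆⇒length≤ : ∀ {xs ys : List ℕ} → Unique xs → xs ⊆ ys → length xs ≤ length ys
Unique∧⊆⇒length≤ u xs⊆ys = injective⇒≤ {f = λ i → index (xs⊆ys (∈-lookup i))}
  (λ {i} {j} eq → Unique⇒lookup-injective u
    (index-injective (setoid ℕ) (xs⊆ys (∈-lookup i)) (xs⊆ys (∈-lookup j)) eq))

Unique∧⊆⇒length≤card : ∀ {xs : List ℕ} {B : FinSet} → Unique xs → xs ⊆ B → length xs ≤ card B
Unique∧⊆⇒length≤card u xs⊆B = Unique∧⊆⇒length≤ u (λ x∈ → ∈-deduplicate⁺ _≟_ (xs⊆B x∈))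

card-mono : ∀ {A B : FinSet} → A ⊆ B → card A ≤ card B
card-mono {A} A⊆B = Unique∧⊆⇒length≤card (deduplicate-! _≟_ A) (λ x∈ → A⊆B (∈-deduplicate⁻ _≟_ A x∈))

card≡0⇒≡[] : ∀ A → card A ≡ 0 → A ≡ []
card≡0⇒≡[] [] _ = refl

-- _≟_ on ℕ decides by _≡ᵇ_, so casing on a ≡ᵇ b is what lets deduplicate compute.
card-pair : ∀ {a b} → a ≢ b → card (a ∷ b ∷ []) ≡ 2
card-pair {a} {b} a≢b with a ≡ᵇ b in a≡ᵇb
... | true = contradiction (≡ᵇ⇒≡ a b (subst T (sym a≡ᵇb) _)) a≢b
... | false = refl

Unique⇒<-pair : ∀ {xs : List ℕ} → Unique xs → 2 ≤ length xs → ∃₂ λ a a' → a ∈ xs × a' ∈ xs × a < a'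
Unique⇒<-pair {_ ∷ []} _ (s≤s ())
Unique⇒<-pair {x ∷ y ∷ _} (x∉ ∷ _) _ with <-cmp x y
... | tri< x<y _ _ = x , y , here refl , there (here refl) , x<y
... | tri≈ _ x≡y _ = contradiction x≡y (All.lookup x∉ (here refl))
... | tri> _ _ y<x = y , x , there (here refl) , here refl , y<x

2≤card⇒<-pair : ∀ A → 2 ≤ card A → ∃₂ λ a a' → a ∈ A × a' ∈ A × a < a'
2≤card⇒<-pair A 2≤card with Unique⇒<-pair (deduplicate-! _≟_ A) 2≤card
... | a , a' , a∈ , a'∈ , a<a' = a , a' , ∈-deduplicate⁻ _≟_ A a∈ , ∈-deduplicate⁻ _≟_ A a'∈ , a<a'

maximum-∈ : ∀ (a : ℕ) as → maximum a as ∈ a ∷ as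
maximum-∈ a as = argmax-all (λ x → x) {P = _∈ a ∷ as} (here refl) (All.tabulate there)

≤-maximum : ∀ (a : ℕ) as {z} → z ∈ a ∷ as → z ≤ maximum a as
≤-maximum a as (here refl) = x≤maximum a as
≤-maximum a as (there z∈as) = All.lookup (xs≤max a as) z∈as

-- The translate A + b has card A elements, and max A + b' lies above all of them.
card<card-⊕ : ∀ A B {x b b'} → x ∈ A → b ∈ B → b' ∈ B → b < b' → card A < card (A ⊕ B)
card<card-⊕ A@(a ∷ as) B {b = b} {b'} _ b∈B b'∈B b<b' =
  subst (_≤ card (A ⊕ B)) (cong suc (length-map (_+ b) D)) (Unique∧⊆⇒length≤card unique ⊆A⊕B)
  where
  D = deduplicate _≟_ A
  m = maximum a as

  unique : Unique (m + b' ∷ map (_+ b) D)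
  unique = All.tabulate top-new ∷ Unique.map⁺ (λ {x} {y} → +-cancelʳ-≡ b x y) (deduplicate-! _≟_ A)
    where
    top-new : ∀ {z} → z ∈ map (_+ b) D → m + b' ≢ z
    top-new z∈ eq with ∈-map⁻ (_+ b) z∈
    ... | a' , a'∈D , refl =
      <-irrefl (sym eq) (+-mono-≤-< (≤-maximum a as (∈-deduplicate⁻ _≟_ A a'∈D)) b<b')

  ⊆A⊕B : m + b' ∷ map (_+ b) D ⊆ A ⊕ B
  ⊆A⊕B (here refl) = ∈-cartesianProductWith⁺ _+_ (maximum-∈ a as) b'∈B
  ⊆A⊕B (there z∈) with ∈-map⁻ (_+ b) z∈
  ... | a' , a'∈D , refl = ∈-cartesianProductWith⁺ _+_ (∈-deduplicate⁻ _≟_ A a'∈D) b∈B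

⊕-comm-⊆ : ∀ A B → A ⊕ B ⊆ B ⊕ A
⊕-comm-⊆ A B z∈ with ∈-cartesianProductWith⁻ _+_ A B z∈
... | a , b , a∈A , b∈B , refl = subst (_∈ B ⊕ A) (+-comm b a) (∈-cartesianProductWith⁺ _+_ b∈B a∈A)

card-⊕-comm : ∀ A B → card (A ⊕ B) ≡ card (B ⊕ A)
card-⊕-comm A B = ≤-antisym (card-mono (⊕-comm-⊆ A B)) (card-mono (⊕-comm-⊆ B A))

card⊔card<card-⊕ : ∀ A B → 2 ≤ card A → 2 ≤ card B → card A ⊔ card B < card (A ⊕ B)
card⊔card<card-⊕ A B 2≤∣A∣ 2≤∣B∣
  with 2≤card⇒<-pair A 2≤∣A∣ | 2≤card⇒<-pair B 2≤∣B∣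
... | a , a' , a∈A , a'∈A , a<a' | b , b' , b∈B , b'∈B , b<b' =
  ⊔-lub (card<card-⊕ A B a∈A b∈B b'∈B b<b')
        (subst (card B <_) (card-⊕-comm B A) (card<card-⊕ B A b∈B a∈A a'∈A a<a'))

2^-injective : ∀ {a b} → 2 ^ a ≡ 2 ^ b → a ≡ b
2^-injective {a} {b} eq with <-cmp a b
... | tri< a<b _ _ = contradiction eq (<⇒≢ (^-monoʳ-< 2 (s≤s (s≤s z≤n)) a<b))
... | tri≈ _ a≡b _ = a≡b
... | tri> _ _ b<a = contradiction eq (>⇒≢ (^-monoʳ-< 2 (s≤s (s≤s z≤n)) b<a))

-- Binary expansions are unique: compare parities, then halve.
2^+2^-injective : ∀ {a b c d} → a < b → c < d →
                  2 ^ a + 2 ^ b ≡ 2 ^ c + 2 ^ d → a ≡ c × b ≡ d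
2^+2^-injective {zero} {_} {zero} _ _ eq = refl , 2^-injective (suc-injective eq)
2^+2^-injective {zero} {suc b} {suc c} {suc d} _ _ eq =
  contradiction (trans (*-distribˡ-+ 2 (2 ^ c) (2 ^ d)) (sym eq)) (even≢odd (2 ^ c + 2 ^ d) (2 ^ b))
2^+2^-injective {suc a} {suc b} {zero} {suc d} _ _ eq =
  contradiction (trans (*-distribˡ-+ 2 (2 ^ a) (2 ^ b)) eq) (even≢odd (2 ^ a + 2 ^ b) (2 ^ d))
2^+2^-injective {suc a} {suc b} {suc c} {suc d} (s≤s a<b) (s≤s c<d) eq =
  let a≡c , b≡d = 2^+2^-injective a<b c<d (*-cancelˡ-≡ _ _ 2 halved) in cong suc a≡c , cong suc b≡d
  where
  halved : 2 * (2 ^ a + 2 ^ b) ≡ 2 * (2 ^ c + 2 ^ d)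
  halved = begin
    2 * (2 ^ a + 2 ^ b)       ≡⟨ *-distribˡ-+ 2 (2 ^ a) (2 ^ b) ⟩
    2 ^ suc a + 2 ^ suc b     ≡⟨ eq ⟩
    2 ^ suc c + 2 ^ suc d     ≡⟨ *-distribˡ-+ 2 (2 ^ c) (2 ^ d) ⟨
    2 * (2 ^ c + 2 ^ d)       ∎
    where open ≡-Reasoning

2^+2^-unordered-injective : ∀ {a b c d} → a ≢ b → c ≢ d → 2 ^ a + 2 ^ b ≡ 2 ^ c + 2 ^ d →
                            (a ≡ c × b ≡ d) ⊎ (a ≡ d × b ≡ c)
2^+2^-unordered-injective {a} {b} {c} {d} a≢b c≢d eq with <-cmp a b | <-cmp c d
... | tri≈ _ a≡b _ | _ = contradiction a≡b a≢b
... | _ | tri≈ _ c≡d _ = contradiction c≡d c≢d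
... | tri< a<b _ _ | tri< c<d _ _ = inj₁ (2^+2^-injective a<b c<d eq)
... | tri< a<b _ _ | tri> _ _ d<c =
  let a≡d , b≡c = 2^+2^-injective a<b d<c (trans eq (+-comm (2 ^ c) _)) in inj₂ (a≡d , b≡c)
... | tri> _ _ b<a | tri< c<d _ _ =
  let b≡c , a≡d = 2^+2^-injective b<a c<d (trans (+-comm (2 ^ b) _) eq) in inj₂ (a≡d , b≡c)
... | tri> _ _ b<a | tri> _ _ d<c =
  let b≡d , a≡c = 2^+2^-injective b<a d<c (trans (+-comm (2 ^ b) _) (trans eq (+-comm (2 ^ c) _)))
  in inj₁ (a≡c , b≡d)

≢0∧≢1⇒2≤ : ∀ {k} → k ≢ 0 → k ≢ 1 → 2 ≤ k
≢0∧≢1⇒2≤ {zero} k≢0 _ = contradiction refl k≢0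
≢0∧≢1⇒2≤ {suc zero} _ k≢1 = contradiction refl k≢1
≢0∧≢1⇒2≤ {suc (suc _)} _ _ = s≤s (s≤s z≤n)

module _ {n : ℕ} (G : Graph n) where

  ∈-nonMono⇒card≢1 : ∀ {f u} → u Subset.∈ nonMono G f → card (f u) ≢ 1
  ∈-nonMono⇒card≢1 {f} {u} u∈ ∣fu∣≡1 =
    subst (λ k → not (k ≡ᵇ 1) ≢ true) (sym ∣fu∣≡1) (λ ())
      (trans (sym (lookup∘tabulate _ u)) ([]=⇒lookup u∈))

  module _ {f : Fin n → FinSet} (weakIASI : IsWeakIASI G f) where
    open IsWeakIASI weakIASI
    open IsIASI iasi

    card-label≢0 : ∀ {u v} → E G u v → card (f u) ≢ 0
    card-label≢0 {u} {v} uv ∣fu∣≡0 = irrefl G (subst (E G u) (sym u≡v) uv)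
      where
      fu≡[] : f u ≡ []
      fu≡[] = card≡0⇒≡[] (f u) ∣fu∣≡0

      ∣fv∣≡0 : card (f v) ≡ 0
      ∣fv∣≡0 = begin
        card (f v)                 ≡⟨ cong (_⊔ card (f v)) ∣fu∣≡0 ⟨
        card (f u) ⊔ card (f v)    ≡⟨ weak u v uv ⟨
        card (f u ⊕ f v)           ≡⟨ cong (λ A → card (A ⊕ f v)) fu≡[] ⟩
        0                          ∎
        where open ≡-Reasoning

      u≡v : u ≡ v
      u≡v = vinj u v (subst (f u ≃ₛ_) (trans fu≡[] (sym (card≡0⇒≡[] (f v) ∣fv∣≡0))) (λ x → ⇔-id (x ∈ f u)))

    nonMono-independent : Independent G (nonMono G f)
    nonMono-independent u v u∈ v∈ uv =
      <-irrefl (sym (weak u v uv))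
        (card⊔card<card-⊕ (f u) (f v)
          (≢0∧≢1⇒2≤ (card-label≢0 uv) (∈-nonMono⇒card≢1 {f} u∈))
          (≢0∧≢1⇒2≤ (card-label≢0 (Graph.sym G uv)) (∈-nonMono⇒card≢1 {f} v∈)))

IsLeast : ℕ → FinSet → Set
IsLeast x A = x ∈ A × (∀ {z} → z ∈ A → x ≤ z)

IsLeast-⊕ : ∀ {x y A B} → IsLeast x A → IsLeast y B → IsLeast (x + y) (A ⊕ B)
IsLeast-⊕ {A = A} {B} (x∈A , x≤A) (y∈B , y≤B) = ∈-cartesianProductWith⁺ _+_ x∈A y∈B , x+y≤
  where
  x+y≤ : ∀ {z} → z ∈ A ⊕ B → _ ≤ z
  x+y≤ z∈ with ∈-cartesianProductWith⁻ _+_ A B z∈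
  ... | a , b , a∈A , b∈B , refl = +-mono-≤ (x≤A a∈A) (y≤B b∈B)

IsLeast-≃ₛ : ∀ {x y A B} → A ≃ₛ B → IsLeast x A → IsLeast y B → x ≡ y
IsLeast-≃ₛ {x} {y} A≃B (x∈A , x≤A) (y∈B , y≤B) =
  ≤-antisym (x≤A (Equivalence.from (A≃B y) y∈B)) (y≤B (Equivalence.to (A≃B x) x∈A))

pointOrPair : Bool → ℕ → FinSet
pointOrPair false x = x ∷ []
pointOrPair true x = x ∷ suc x ∷ []

IsLeast-pointOrPair : ∀ b x → IsLeast x (pointOrPair b x)
IsLeast-pointOrPair false x = here refl , λ { (here refl) → ≤-refl }
IsLeast-pointOrPair true x = here refl , λ { (here refl) → ≤-refl ; (there (here refl)) → n≤1+n x }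

card-pointOrPair-true : ∀ x → card (pointOrPair true x) ≡ 2
card-pointOrPair-true x = card-pair {x} (<⇒≢ (n<1+n x))

not-card≡ᵇ1-pointOrPair : ∀ b x → not (card (pointOrPair b x) ≡ᵇ 1) ≡ b
not-card≡ᵇ1-pointOrPair false x = refl
not-card≡ᵇ1-pointOrPair true x = cong (λ k → not (k ≡ᵇ 1)) (card-pointOrPair-true x)

module _ {n : ℕ} (G : Graph n) (S : Subset n) (S-independent : Independent G S) where

  private
    x : Fin n → ℕ
    x i = 2 ^ toℕ i

  pointOrPairLabelling : Fin n → FinSet
  pointOrPairLabelling i = pointOrPair (lookup S i) (x i)

  private
    f = pointOrPairLabelling

    IsLeast-f : ∀ i → IsLeast (x i) (f i)
    IsLeast-f i = IsLeast-pointOrPair (lookup S i) (x i)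

    f-injective : ∀ u v → f u ≃ₛ f v → u ≡ v
    f-injective u v fu≃fv = toℕ-injective (2^-injective (IsLeast-≃ₛ fu≃fv (IsLeast-f u) (IsLeast-f v)))

    edge-endpoints-differ : ∀ {u v} → E G u v → toℕ u ≢ toℕ v
    edge-endpoints-differ {u} uv u≡v = irrefl G (subst (E G u) (sym (toℕ-injective u≡v)) uv)

    g-injective : ∀ u v u' v' → E G u v → E G u' v' → (f u ⊕ f v) ≃ₛ (f u' ⊕ f v') →
                  (u ≡ u' × v ≡ v') ⊎ (u ≡ v' × v ≡ u')
    g-injective u v u' v' uv u'v' g≃g'
      with 2^+2^-unordered-injective (edge-endpoints-differ uv) (edge-endpoints-differ u'v')
             (IsLeast-≃ₛ g≃g' (IsLeast-⊕ (IsLeast-f u) (IsLeast-f v)) (IsLeast-⊕ (IsLeast-f u') (IsLeast-f v')))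
    ... | inj₁ (u≡u' , v≡v') = inj₁ (toℕ-injective u≡u' , toℕ-injective v≡v')
    ... | inj₂ (u≡v' , v≡u') = inj₂ (toℕ-injective u≡v' , toℕ-injective v≡u')

    weak : ∀ u v → E G u v → card (f u ⊕ f v) ≡ max (card (f u)) (card (f v))
    weak u v uv with lookup S u in Su | lookup S v in Sv
    ... | true | true = contradiction uv (S-independent u v (lookup⇒[]= u S Su) (lookup⇒[]= v S Sv))
    ... | false | false = refl
    ... | true | false =
      trans (card-pointOrPair-true (x u + x v)) (cong (_⊔ 1) (sym (card-pointOrPair-true (x u))))
    ... | false | true =
      trans (card-pair (<⇒≢ (+-monoʳ-< (x u) (n<1+n (x v))))) (sym (card-pointOrPair-true (x v)))

  pointOrPairLabelling-isWeakIASI : IsWeakIASI G pointOrPairLabelling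
  pointOrPairLabelling-isWeakIASI = record
    { iasi = record { vinj = f-injective ; einj = g-injective }
    ; weak = weak
    }

  nonMono-pointOrPairLabelling : nonMono G pointOrPairLabelling ≡ S
  nonMono-pointOrPairLabelling =
    trans (tabulate-cong (λ i → not-card≡ᵇ1-pointOrPair (lookup S i) (x i))) (tabulate∘lookup S)

-- The hypothesis that G is a weak IASI graph is redundant: pointOrPairLabelling is one.
mainTheorem10 : ∀ {n : ℕ} (G : Graph n) → IsWeakIASIGraph G →
    ∀ (k : ℕ) → IsIndependenceNumber G k →
    (Σ (Fin n → FinSet) λ f → IsWeakIASI G f × ∣ nonMono G f ∣ ≡ k) ×
    (∀ (f : Fin n → FinSet) → IsWeakIASI G f → ∣ nonMono G f ∣ ≤ k)
mainTheorem10 G _ k ((S , S-independent , ∣S∣≡k) , ∣indep∣≤k) =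
  ( pointOrPairLabelling G S S-independent
  , pointOrPairLabelling-isWeakIASI G S S-independent
  , trans (cong ∣_∣ (nonMono-pointOrPairLabelling G S S-independent)) ∣S∣≡k
  )
  , λ f weakIASI → ∣indep∣≤k (nonMono G f) (nonMono-independent G weakIASI)
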